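{- Every level-1 network is 1-nested.
   Context: An evolutionary network is a rooted directed acyclic graph whose leaves are bijectively labeled by a set of taxa. A tree node is a node of in-degree at most 1; a hybrid node is a node of in-degree at least 2. A reticulation cycle for a hybrid node $h$ is a pair of distinct non-trivial directed paths with a common origin (the split node), both ending in $h$ (the end), that have no intermediate (non-endpoint) nodes in common; the intermediate nodes of the reticulation cycle are the intermediate nodes of these two paths. A network is 1-nested when every pair of reticulation cycles with different ends have disjoint sets of intermediate nodes. A subgraph of a network is biconnected if it is biconnected in the underlying undirected graph (connected, and remains connected after deleting any single node with its incident edges). A network is level-1 when no biconnected subgraph of it contains more than one hybrid node. No restriction on node degrees is imposed. -}

module Defs where

open import Data.Nat using (ℕ)
open import Data.Fin using (Fin)
open import Data.List using (List; []; _∷_; _++_)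
open import Data.List.Membership.Propositional using (_∈_)
open import Data.List.Relation.Unary.Linked using (Linked)
open import Data.Product using (Σ; ∃; _×_; _,_)
open import Data.Sum using (_⊎_)
open import Data.Empty using (⊥)
open import Relation.Nullary using (¬_)
open import Relation.Binary.PropositionalEquality using (_≡_; _≢_)
open import Relation.Binary.Construct.Closure.ReflexiveTransitive using (Star)
open import Function.Bundles using (_⤖_)

Digraph : ℕ → Set₁
Digraph n = Fin n → Fin n → Set

module _ {n : ℕ} (E : Digraph n) where

  -- A non-trivial directed path s → mids → t: the node list s ∷ mids ++ [t]
  -- with consecutive nodes joined by arcs (at least one arc).
  -- Its intermediate nodes are the elements of mids.
  IsPath : Fin n → List (Fin n) → Fin n → Set
  IsPath s mids t = Linked E (s ∷ mids ++ (t ∷ []))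

  Acyclic : Set
  Acyclic = ∀ v mids → ¬ IsPath v mids v

  InDeg0 : Fin n → Set
  InDeg0 v = ∀ u → ¬ E u v

  IsLeaf : Fin n → Set
  IsLeaf v = ∀ u → ¬ E v u

  IsHybrid : Fin n → Set
  IsHybrid h = Σ (Fin n) λ u₁ → Σ (Fin n) λ u₂ → u₁ ≢ u₂ × E u₁ h × E u₂ h

record Network (X : Set) : Set₁ where
  field
    n       : ℕ
    E       : Digraph n
    acyclic : Acyclic E
    root    : Fin n
    root-in : InDeg0 E root
    rooted  : ∀ v → Star E root v
    label   : Σ (Fin n) (IsLeaf E) ⤖ X

module _ {X : Set} (N : Network X) where
  open Network N

  record RetCycle : Set where
    field
      split end  : Fin n
      end-hybrid : IsHybrid E end
      mids₁ mids₂ : List (Fin n)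
      path₁ : IsPath E split mids₁ end
      path₂ : IsPath E split mids₂ end
      distinct : mids₁ ≢ mids₂
      disjoint : ∀ x → x ∈ mids₁ → x ∈ mids₂ → ⊥

  Intermediate : RetCycle → Fin n → Set
  Intermediate C x = x ∈ RetCycle.mids₁ C ⊎ x ∈ RetCycle.mids₂ C

  OneNested : Set
  OneNested = ∀ (C₁ C₂ : RetCycle) → RetCycle.end C₁ ≢ RetCycle.end C₂ →
              ∀ x → Intermediate C₁ x → Intermediate C₂ x → ⊥

  record Subgraph : Set₁ where
    field
      V : Fin n → Set
      A : Fin n → Fin n → Set
      A⊆E : ∀ {u v} → A u v → E u v × V u × V v

  module _ (S : Subgraph) where
    open Subgraph S

    UAdj : Fin n → Fin n → Set
    UAdj u v = A u v ⊎ A v u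

    UAdjWithout : Fin n → Fin n → Fin n → Set
    UAdjWithout w u v = UAdj u v × u ≢ w × v ≢ w

    Connected : Set
    Connected = ∀ u v → V u → V v → Star UAdj u v

    Biconnected : Set
    Biconnected = Connected ×
      (∀ w → V w → ∀ u v → V u → V v → u ≢ w → v ≢ w →
         Star (UAdjWithout w) u v)

    TwoHybrids : Set
    TwoHybrids = Σ (Fin n) λ h₁ → Σ (Fin n) λ h₂ →
      h₁ ≢ h₂ × V h₁ × V h₂ × IsHybrid E h₁ × IsHybrid E h₂

  Level1 : Set₁
  Level1 = ∀ (S : Subgraph) → Biconnected S → ¬ TwoHybrids S

module Submission where

-- Suppose two reticulation cycles C₁, C₂ with distinct ends h₁ ≢ h₂
-- share an intermediate node x, and let pᵢ → x be the arc by which the path of Cᵢ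
-- through x enters x.
--   * If p₁ ≢ p₂, then x is a hybrid node distinct from h₁ lying on C₁.
--   * If p₁ ≡ p₂, then C₁ and C₂ share the two distinct nodes x and p₁, so their
--     union is biconnected, and it contains the two hybrid nodes h₁ and h₂.
-- Since the subgraph formed by a reticulation cycle is biconnected, both cases
-- contradict level-1.

open import Defs
open import Data.Nat using (ℕ)
open import Data.Fin using (Fin; _≟_)
open import Data.List using (List; []; _∷_)
open import Data.List.Membership.Propositional using (_∈_; _∉_)
open import Data.List.Relation.Unary.Any using (here; there)
open import Data.List.Relation.Unary.Linked using ([-]; _∷_)
open import Data.Product using (Σ; _×_; _,_; proj₁; proj₂)
open import Data.Sum using (_⊎_; inj₁; inj₂)
open import Data.Empty using (⊥; ⊥-elim)
open import Relation.Nullary using (¬_; yes; no)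
open import Relation.Binary.Definitions using (Symmetric)
open import Relation.Binary.PropositionalEquality using (_≡_; _≢_; refl; sym)
open import Relation.Binary.Construct.Closure.ReflexiveTransitive
  using (Star; ε; _◅_; _◅◅_; reverse) renaming (map to mapStar)
import Data.List.Membership.DecPropositional as DecMembership

Avoiding : {A : Set} → A → (A → A → Set) → A → A → Set
Avoiding w R u v = R u v × u ≢ w × v ≢ w

module _ {A : Set} {R : A → A → Set} where

  meet : Symmetric R → ∀ {u v c} → Star R u c → Star R v c → Star R u v
  meet R-sym u⇝c v⇝c = u⇝c ◅◅ reverse R-sym v⇝c

  avoiding-sym : ∀ {w} → Symmetric R → Symmetric (Avoiding w R)
  avoiding-sym R-sym (r , u≢w , v≢w) = R-sym r , v≢w , u≢w

  avoiding-map : ∀ {w} {R′ : A → A → Set} → (∀ {u v} → R u v → R′ u v) →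
                 ∀ {u v} → Avoiding w R u v → Avoiding w R′ u v
  avoiding-map f (r , u≢w , v≢w) = f r , u≢w , v≢w

  walkEnd-≢ : ∀ {w u v} → Star (Avoiding w R) u v → u ≢ w → v ≢ w
  walkEnd-≢ ε         u≢w = u≢w
  walkEnd-≢ (r ◅ rs) _   = walkEnd-≢ rs (proj₂ (proj₂ r))

module _ {A : Set} where

  OnRoute : A → List A → A → A → Set
  OnRoute a []       b v = v ≡ a ⊎ v ≡ b
  OnRoute a (c ∷ xs) b v = v ≡ a ⊎ OnRoute c xs b v

  RouteArc : A → List A → A → A → A → Set
  RouteArc a []       b u v = u ≡ a × v ≡ b
  RouteArc a (c ∷ xs) b u v = (u ≡ a × v ≡ c) ⊎ RouteArc c xs b u v

  onRoute-start : ∀ {a} xs {b} → OnRoute a xs b a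
  onRoute-start []      = inj₁ refl
  onRoute-start (_ ∷ _) = inj₁ refl

  onRoute-end : ∀ {a} xs {b} → OnRoute a xs b b
  onRoute-end []       = inj₂ refl
  onRoute-end (_ ∷ xs) = inj₂ (onRoute-end xs)

  routeArc-ends : ∀ {a} xs {b u v} → RouteArc a xs b u v →
                  OnRoute a xs b u × OnRoute a xs b v
  routeArc-ends []       (refl , refl)        = inj₁ refl , inj₂ refl
  routeArc-ends (_ ∷ xs) (inj₁ (refl , refl)) = onRoute-start (_ ∷ xs) , inj₂ (onRoute-start xs)
  routeArc-ends (_ ∷ xs) (inj₂ q)             =
    let (u-on , v-on) = routeArc-ends xs q in inj₂ u-on , inj₂ v-on

  predecessor : ∀ {a} xs {b x} → x ∈ xs → Σ A λ p → RouteArc a xs b p x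
  predecessor (_ ∷ _)  (here refl) = _ , inj₁ (refl , refl)
  predecessor (_ ∷ xs) (there x∈xs) =
    let (p , arc) = predecessor xs x∈xs in p , inj₂ arc

  route-avoids : ∀ {a} xs {b w} → a ≢ w → w ∉ xs → b ≢ w →
                 ∀ {v} → OnRoute a xs b v → v ≢ w
  route-avoids []       a≢w _   _   (inj₁ refl) = a≢w
  route-avoids []       _   _   b≢w (inj₂ refl) = b≢w
  route-avoids (_ ∷ _)  a≢w _   _   (inj₁ refl) = a≢w
  route-avoids (_ ∷ xs) _   w∉  b≢w (inj₂ on)   =
    route-avoids xs (λ { refl → w∉ (here refl) }) (λ w∈ → w∉ (there w∈)) b≢w on

  toEnd : ∀ {R : A → A → Set} {a} xs {b} → (∀ {u v} → RouteArc a xs b u v → R u v) →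
          ∀ {u} → OnRoute a xs b u → Star R u b
  toEnd []       lift (inj₁ refl) = lift (refl , refl) ◅ ε
  toEnd []       _    (inj₂ refl) = ε
  toEnd (_ ∷ xs) lift (inj₁ refl) =
    lift (inj₁ (refl , refl)) ◅ toEnd xs (λ q → lift (inj₂ q)) (onRoute-start xs)
  toEnd (_ ∷ xs) lift (inj₂ on)   = toEnd xs (λ q → lift (inj₂ q)) on

  toEnd-avoiding : ∀ {R : A → A → Set} {a} xs {b w} → (∀ {v} → OnRoute a xs b v → v ≢ w) →
                   (∀ {u v} → RouteArc a xs b u v → R u v) →
                   ∀ {u} → OnRoute a xs b u → Star (Avoiding w R) u b
  toEnd-avoiding xs fresh lift = toEnd xs λ q →
    let (u-on , v-on) = routeArc-ends xs q in lift q , fresh u-on , fresh v-on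

data Path {n : ℕ} (E : Digraph n) : Fin n → List (Fin n) → Fin n → Set where
  edge : ∀ {a b} → E a b → Path E a [] b
  _∷ₚ_ : ∀ {a c xs b} → E a c → Path E c xs b → Path E a (c ∷ xs) b

module _ {n : ℕ} {E : Digraph n} where

  fromIsPath : ∀ {a} xs {b} → IsPath E a xs b → Path E a xs b
  fromIsPath []       (r ∷ [-])  = edge r
  fromIsPath (_ ∷ xs) (r ∷ rest) = r ∷ₚ fromIsPath xs rest

  toIsPath : ∀ {a xs b} → Path E a xs b → IsPath E a xs b
  toIsPath (edge r)  = r ∷ [-]
  toIsPath (r ∷ₚ p)  = r ∷ toIsPath p

  path-arc : ∀ {a xs b u v} → Path E a xs b → RouteArc a xs b u v → E u v
  path-arc (edge r) (refl , refl)        = r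
  path-arc (r ∷ₚ _) (inj₁ (refl , refl)) = r
  path-arc (_ ∷ₚ p) (inj₂ q)             = path-arc p q

  walkFrom : ∀ {a xs b v} → Path E a xs b → OnRoute a xs b v → Star E a v
  walkFrom (edge _) (inj₁ refl) = ε
  walkFrom (edge r) (inj₂ refl) = r ◅ ε
  walkFrom (_ ∷ₚ _) (inj₁ refl) = ε
  walkFrom (r ∷ₚ p) (inj₂ on)   = r ◅ walkFrom p on

  arcThenWalk : ∀ {a c d} → E a c → Star E c d → Σ (List (Fin n)) λ ys → Path E a ys d
  arcThenWalk r ε        = [] , edge r
  arcThenWalk r (s ◅ ss) = let (ys , p) = arcThenWalk s ss in _ ∷ ys , r ∷ₚ p

  suffix : ∀ {a xs b x} → Path E a xs b → x ∈ xs → Σ (List (Fin n)) λ ys → Path E x ys b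
  suffix (_ ∷ₚ p) (here refl)  = _ , p
  suffix (_ ∷ₚ p) (there x∈xs) = suffix p x∈xs

  module _ (acyclic : Acyclic E) where

    noReturn : ∀ {a c} → E a c → Star E c a → ⊥
    noReturn r back = let (ys , cycle) = arcThenWalk r back in acyclic _ ys (toIsPath cycle)

    later-≢-start : ∀ {a c xs b v} → E a c → Path E c xs b → OnRoute c xs b v → v ≢ a
    later-≢-start r p on refl = noReturn r (walkFrom p on)

    mid-≢-end : ∀ {a xs b x} → Path E a xs b → x ∈ xs → x ≢ b
    mid-≢-end p x∈xs refl = let (ys , cycle) = suffix p x∈xs in acyclic _ ys (toIsPath cycle)

    -- Deleting any node w, every other node of a path still reaches one of its
    -- ends along the path.  If the start is w, the rest of the path avoids it.
    reachEnd : ∀ {R : Fin n → Fin n → Set} → Symmetric R → ∀ {a xs b} → Path E a xs b →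
               (∀ {u v} → RouteArc a xs b u v → R u v) →
               ∀ w {u} → OnRoute a xs b u → u ≢ w →
               Star (Avoiding w R) u a ⊎ Star (Avoiding w R) u b
    reachEnd _ (edge _) _ _ (inj₁ refl) _ = inj₁ ε
    reachEnd _ (edge _) _ _ (inj₂ refl) _ = inj₂ ε
    reachEnd _ (_ ∷ₚ _) _ _ (inj₁ refl) _ = inj₁ ε
    reachEnd R-sym {a} (r ∷ₚ p) lift w (inj₂ on) u≢w
      with reachEnd R-sym p (λ q → lift (inj₂ q)) w on u≢w | a ≟ w
    ... | inj₂ u⇝b    | _        = inj₂ u⇝b
    ... | inj₁ u⇝next | no a≢w  =
      inj₁ (u⇝next ◅◅ (R-sym (lift (inj₁ (refl , refl))) , walkEnd-≢ u⇝next u≢w , a≢w) ◅ ε)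
    ... | inj₁ _      | yes refl =
      inj₂ (toEnd-avoiding _ (later-≢-start r p) (λ q → lift (inj₂ q)) on)

module _ {X : Set} (N : Network X) where
  open Network N
  open Subgraph using (V; A; A⊆E)

  -- Biconnectivity where the deleted node may also lie outside the subgraph;
  -- this stronger form is what survives gluing subgraphs together.
  StronglyBiconnected : Subgraph N → Set
  StronglyBiconnected S = Connected N S ×
    (∀ w {u v} → V S u → V S v → u ≢ w → v ≢ w → Star (Avoiding w (UAdj N S)) u v)

  level1-forbids : Level1 N → ∀ S → StronglyBiconnected S → ¬ TwoHybrids N S
  level1-forbids level1 S (connected , deletion) =
    level1 S (connected , λ w _ _ _ Vu Vv u≢w v≢w → deletion w Vu Vv u≢w v≢w)

  uadj-sym : ∀ S → Symmetric (UAdj N S)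
  uadj-sym _ (inj₁ a) = inj₂ a
  uadj-sym _ (inj₂ a) = inj₁ a

  pathPair : ∀ {s m₁ m₂ t} → Path E s m₁ t → Path E s m₂ t → Subgraph N
  pathPair {s} {m₁} {m₂} {t} p₁ p₂ = record
    { V   = λ v → OnRoute s m₁ t v ⊎ OnRoute s m₂ t v
    ; A   = λ u v → RouteArc s m₁ t u v ⊎ RouteArc s m₂ t u v
    ; A⊆E = λ { (inj₁ q) → let (u-on , v-on) = routeArc-ends m₁ q in
                             path-arc p₁ q , inj₁ u-on , inj₁ v-on
              ; (inj₂ q) → let (u-on , v-on) = routeArc-ends m₂ q in
                             path-arc p₂ q , inj₂ u-on , inj₂ v-on } }

  module PathPair {s m₁ m₂ t} (p₁ : Path E s m₁ t) (p₂ : Path E s m₂ t)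
                  (disjoint : ∀ x → x ∈ m₁ → x ∈ m₂ → ⊥) where
    private
      S : Subgraph N
      S = pathPair p₁ p₂
      Adj : Fin n → Fin n → Set
      Adj = UAdj N S
      _⇝[_]_ : Fin n → Fin n → Fin n → Set
      u ⇝[ w ] v = Star (Avoiding w Adj) u v

    toTarget : ∀ {u} → V S u → Star Adj u t
    toTarget (inj₁ on) = toEnd m₁ (λ q → inj₁ (inj₁ q)) on
    toTarget (inj₂ on) = toEnd m₂ (λ q → inj₁ (inj₂ q)) on

    reachEnds : ∀ w {u} → V S u → u ≢ w → u ⇝[ w ] s ⊎ u ⇝[ w ] t
    reachEnds w (inj₁ on) = reachEnd acyclic (uadj-sym S) p₁ (λ q → inj₁ (inj₁ q)) w on
    reachEnds w (inj₂ on) = reachEnd acyclic (uadj-sym S) p₂ (λ q → inj₁ (inj₂ q)) w on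

    -- With w deleted, s and t remain joined along the path not containing w.
    linkEnds : ∀ {w} → s ≢ w → t ≢ w → s ⇝[ w ] t
    linkEnds {w} s≢w t≢w with DecMembership._∈?_ _≟_ w m₂
    ... | yes w∈m₂ = toEnd-avoiding m₁ (route-avoids m₁ s≢w (λ w∈m₁ → disjoint w w∈m₁ w∈m₂) t≢w)
                                    (λ q → inj₁ (inj₁ q)) (onRoute-start m₁)
    ... | no  w∉m₂ = toEnd-avoiding m₂ (route-avoids m₂ s≢w w∉m₂ t≢w)
                                    (λ q → inj₁ (inj₂ q)) (onRoute-start m₂)

    -- Deleting w, all remaining nodes reach a common hub: t if w is s, and s otherwise.
    deletion : ∀ w {u v} → V S u → V S v → u ≢ w → v ≢ w → u ⇝[ w ] v
    deletion w Vu Vv u≢w v≢w = meet (avoiding-sym (uadj-sym S)) (toHub Vu u≢w) (toHub Vv v≢w)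
      where
        hub : Fin n
        hub with s ≟ w
        ... | yes _ = t
        ... | no  _ = s
        toHub : ∀ {u} → V S u → u ≢ w → u ⇝[ w ] hub
        toHub Vu u≢w with s ≟ w | t ≟ w | reachEnds w Vu u≢w
        ... | yes s≡w | _       | inj₁ u⇝s = ⊥-elim (walkEnd-≢ u⇝s u≢w s≡w)
        ... | yes _   | _       | inj₂ u⇝t = u⇝t
        ... | no  _   | _       | inj₁ u⇝s = u⇝s
        ... | no  _   | yes t≡w | inj₂ u⇝t = ⊥-elim (walkEnd-≢ u⇝t u≢w t≡w)
        ... | no  s≢w | no  t≢w | inj₂ u⇝t =
          u⇝t ◅◅ reverse (avoiding-sym (uadj-sym S)) (linkEnds s≢w t≢w)

    stronglyBiconnected : StronglyBiconnected S
    stronglyBiconnected = (λ _ _ Vu Vv → meet (uadj-sym S) (toTarget Vu) (toTarget Vv)) , deletion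

  union : Subgraph N → Subgraph N → Subgraph N
  union S₁ S₂ = record
    { V   = λ v → V S₁ v ⊎ V S₂ v
    ; A   = λ u v → A S₁ u v ⊎ A S₂ u v
    ; A⊆E = λ { (inj₁ a) → let (e , Vu , Vv) = A⊆E S₁ a in e , inj₁ Vu , inj₁ Vv
              ; (inj₂ a) → let (e , Vu , Vv) = A⊆E S₂ a in e , inj₂ Vu , inj₂ Vv } }

  -- Gluing two strongly biconnected subgraphs along two distinct common nodes a, b
  -- gives a strongly biconnected subgraph: whichever of a, b survives a deletion
  -- serves as a hub for both parts.
  module Union (S₁ S₂ : Subgraph N) (bi₁ : StronglyBiconnected S₁) (bi₂ : StronglyBiconnected S₂)
               {a b : Fin n} (a≢b : a ≢ b) (a∈₁ : V S₁ a) (a∈₂ : V S₂ a)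
               (b∈₁ : V S₁ b) (b∈₂ : V S₂ b) where
    private
      U : Subgraph N
      U = union S₁ S₂

    embed₁ : ∀ {u v} → UAdj N S₁ u v → UAdj N U u v
    embed₁ (inj₁ x) = inj₁ (inj₁ x)
    embed₁ (inj₂ x) = inj₂ (inj₁ x)

    embed₂ : ∀ {u v} → UAdj N S₂ u v → UAdj N U u v
    embed₂ (inj₁ x) = inj₁ (inj₂ x)
    embed₂ (inj₂ x) = inj₂ (inj₂ x)

    toA : ∀ {u} → V U u → Star (UAdj N U) u a
    toA (inj₁ Vu) = mapStar embed₁ (proj₁ bi₁ _ _ Vu a∈₁)
    toA (inj₂ Vu) = mapStar embed₂ (proj₁ bi₂ _ _ Vu a∈₂)

    sharedHub : ∀ w → Σ (Fin n) λ c → c ≢ w × V S₁ c × V S₂ c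
    sharedHub w with a ≟ w
    ... | no  a≢w  = a , a≢w , a∈₁ , a∈₂
    ... | yes refl = b , (λ b≡a → a≢b (sym b≡a)) , b∈₁ , b∈₂

    toCommon : ∀ w {c u} → V S₁ c → V S₂ c → c ≢ w → V U u → u ≢ w →
               Star (Avoiding w (UAdj N U)) u c
    toCommon w c∈₁ _   c≢w (inj₁ Vu) u≢w =
      mapStar (avoiding-map {R = UAdj N S₁} embed₁) (proj₂ bi₁ w Vu c∈₁ u≢w c≢w)
    toCommon w _   c∈₂ c≢w (inj₂ Vu) u≢w =
      mapStar (avoiding-map {R = UAdj N S₂} embed₂) (proj₂ bi₂ w Vu c∈₂ u≢w c≢w)

    deletion : ∀ w {u v} → V U u → V U v → u ≢ w → v ≢ w → Star (Avoiding w (UAdj N U)) u v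
    deletion w Vu Vv u≢w v≢w with sharedHub w
    ... | _ , c≢w , c∈₁ , c∈₂ = meet (avoiding-sym (uadj-sym U))
                                  (toCommon w c∈₁ c∈₂ c≢w Vu u≢w) (toCommon w c∈₁ c∈₂ c≢w Vv v≢w)

    stronglyBiconnected : StronglyBiconnected U
    stronglyBiconnected = (λ _ _ Vu Vv → meet (uadj-sym U) (toA Vu) (toA Vv)) , deletion

  module Cycle (C : RetCycle N) where
    open RetCycle C

    private
      q₁ : Path E split mids₁ end
      q₁ = fromIsPath mids₁ path₁
      q₂ : Path E split mids₂ end
      q₂ = fromIsPath mids₂ path₂

    graph : Subgraph N
    graph = pathPair q₁ q₂

    stronglyBiconnected : StronglyBiconnected graph
    stronglyBiconnected = PathPair.stronglyBiconnected q₁ q₂ disjoint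

    end∈graph : V graph end
    end∈graph = inj₁ (onRoute-end mids₁)

    entry : ∀ {x} → Intermediate N C x → Σ (Fin n) λ p → A graph p x
    entry (inj₁ x∈) = let (p , arc) = predecessor mids₁ x∈ in p , inj₁ arc
    entry (inj₂ x∈) = let (p , arc) = predecessor mids₂ x∈ in p , inj₂ arc

    intermediate-≢-end : ∀ {x} → Intermediate N C x → x ≢ end
    intermediate-≢-end (inj₁ x∈) = mid-≢-end acyclic q₁ x∈
    intermediate-≢-end (inj₂ x∈) = mid-≢-end acyclic q₂ x∈

  intermediate-not-hybrid : Level1 N → (C : RetCycle N) →
                            ∀ {x} → Intermediate N C x → ¬ IsHybrid E x
  intermediate-not-hybrid level1 C {x} x∈C x-hybrid =
    level1-forbids level1 graph stronglyBiconnected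
      (x , end , intermediate-≢-end x∈C , x∈graph , end∈graph , x-hybrid , end-hybrid)
    where
      open Cycle C
      open RetCycle C using (end; end-hybrid)
      x∈graph : V graph x
      x∈graph = proj₂ (proj₂ (A⊆E graph (proj₂ (entry x∈C))))

  -- In a level-1 network, reticulation cycles sharing an arc p → x have the same end:
  -- otherwise their union, biconnected because it is glued along x and p, would
  -- contain the two distinct hybrid ends.
  sharedArc-sameEnd : Level1 N → (C₁ C₂ : RetCycle N) → ∀ {p x} →
                      A (Cycle.graph C₁) p x → A (Cycle.graph C₂) p x →
                      RetCycle.end C₁ ≡ RetCycle.end C₂
  sharedArc-sameEnd level1 C₁ C₂ {p} {x} arc₁ arc₂ with RetCycle.end C₁ ≟ RetCycle.end C₂
  ... | yes h₁≡h₂ = h₁≡h₂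
  ... | no  h₁≢h₂ = ⊥-elim (level1-forbids level1 (union S₁ S₂) glued
        (RetCycle.end C₁ , RetCycle.end C₂ , h₁≢h₂ ,
         inj₁ (Cycle.end∈graph C₁) , inj₂ (Cycle.end∈graph C₂) ,
         RetCycle.end-hybrid C₁ , RetCycle.end-hybrid C₂))
    where
      S₁ S₂ : Subgraph N
      S₁ = Cycle.graph C₁
      S₂ = Cycle.graph C₂
      ends₁ : E p x × V S₁ p × V S₁ x
      ends₁ = A⊆E S₁ arc₁
      ends₂ : E p x × V S₂ p × V S₂ x
      ends₂ = A⊆E S₂ arc₂
      x≢p : x ≢ p
      x≢p refl = noReturn acyclic (proj₁ ends₁) ε
      glued : StronglyBiconnected (union S₁ S₂)
      glued = Union.stronglyBiconnected S₁ S₂ (Cycle.stronglyBiconnected C₁) (Cycle.stronglyBiconnected C₂)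
                x≢p (proj₂ (proj₂ ends₁)) (proj₂ (proj₂ ends₂))
                    (proj₁ (proj₂ ends₁)) (proj₁ (proj₂ ends₂))

-- Let x be a common intermediate node of C₁ and C₂, entered by arcs p₁ → x and p₂ → x.
-- If p₁ ≡ p₂ the cycles share an arc, so their ends agree; otherwise x is hybrid.
proposition1 : ∀ {X : Set} (N : Network X) → Level1 N → OneNested N
proposition1 N level1 C₁ C₂ h₁≢h₂ x x∈C₁ x∈C₂
  with Cycle.entry N C₁ x∈C₁ | Cycle.entry N C₂ x∈C₂
... | p₁ , arc₁ | p₂ , arc₂ with p₁ ≟ p₂
...   | yes refl = h₁≢h₂ (sharedArc-sameEnd N level1 C₁ C₂ arc₁ arc₂)
...   | no p₁≢p₂ = intermediate-not-hybrid N level1 C₁ x∈C₁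
        (p₁ , p₂ , p₁≢p₂ , proj₁ (A⊆E (Cycle.graph N C₁) arc₁) , proj₁ (A⊆E (Cycle.graph N C₂) arc₂))
  where open Subgraph using (A⊆E)
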